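{- Let $0\le i\le n$, let $L\subseteq\{0,1\}^n$ be the set of vectors of Hamming weight $i$, and let $K=\sum_{z\in L}w_z$, where $w_z(y)=(-1)^{\sum_j z_jy_j}$. Let $1\le v\le r$ and $m=r+v$. Let $S_1,\dots,S_v$ be non-empty subsets of $[r]$ such that $S_d\not\subseteq\bigcup_{j=1}^{d-1}S_j$ for all $1\le d\le v$ and $\bigcup_{j=1}^v S_j=[r]$. Let $\mathcal A\subseteq L^m$ be the set of $m$-tuples $(x_1,\dots,x_m)\in L^m$ satisfying $x_{r+d}=\sum_{j\in S_d}x_j$ (over $\mathbb F_2$) for $d=1,\dots,v$. Define $a_d=\bigl|S_d\setminus\bigcup_{j=1}^{d-1}S_j\bigr|+1$ for $d=1,\dots,v$; then $a_d\ge 2$ and $\sum_{d=1}^v a_d=m$, and \[ |\mathcal A|\;\le\;\prod_{d=1}^v \mathbb E_{y_d}\,|K(y_d)|^{a_d}, \] where each $y_d$ is uniform on $\{0,1\}^n$.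
   Context: $K$ is the $i$-th Krawchouk polynomial viewed as a function on $\{0,1\}^n$. -}

module Defs where

open import Data.Bool using (not; Bool; true; false; if_then_else_; _xor_; _∧_)
open import Data.Nat as ℕ using (ℕ; zero; suc; _^_; _<ᵇ_; _≡ᵇ_)
open import Data.Nat.Properties using (m^n≢0)
open import Data.Integer as ℤ using (ℤ; +_)
open import Data.Rational as ℚ using (ℚ)
open import Data.Fin using (Fin; toℕ; _↑ˡ_; _↑ʳ_)
open import Data.Fin.Subset using (Subset; ⋃; _─_; ∣_∣)
open import Data.List as List using (List; []; _∷_; filter; length; allFin; map; foldr; concatMap)
open import Data.Vec as Vec using (Vec; []; _∷_; lookup; replicate; zipWith; count)

boolFilter : ∀ {A : Set} → (A → Bool) → List A → List A
boolFilter p [] = []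
boolFilter p (x ∷ xs) = if p x then x ∷ boolFilter p xs else boolFilter p xs

-- Bit vectors in {0,1}^n, represented as Vec Bool n (true = 1).
BitVec : ℕ → Set
BitVec n = Vec Bool n

weight : ∀ {n} → BitVec n → ℕ
weight [] = 0
weight (true ∷ x) = suc (weight x)
weight (false ∷ x) = weight x

vecsOver : ∀ {A : Set} → List A → (k : ℕ) → List (Vec A k)
vecsOver xs zero = [] ∷ []
vecsOver xs (suc k) = concatMap (λ a → map (a ∷_) (vecsOver xs k)) xs

allBitVecs : (n : ℕ) → List (BitVec n)
allBitVecs n = vecsOver (false ∷ true ∷ []) n

levelSet : (n i : ℕ) → List (BitVec n)
levelSet n i = boolFilter (λ z → weight z ≡ᵇ i) (allBitVecs n)

dotF2 : ∀ {n} → BitVec n → BitVec n → Bool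
dotF2 [] [] = false
dotF2 (a ∷ z) (b ∷ y) = (a ∧ b) xor dotF2 z y

character : ∀ {n} → BitVec n → BitVec n → ℤ
character z y = if dotF2 z y then ℤ.- (+ 1) else + 1

sumℤ : List ℤ → ℤ
sumℤ = foldr ℤ._+_ (+ 0)

sumℕ : List ℕ → ℕ
sumℕ = foldr ℕ._+_ 0

prodℚ : List ℚ → ℚ
prodℚ = foldr ℚ._*_ ℚ.1ℚ

-- K = Σ_{z ∈ L} w_z  (the i-th Krawtchouk polynomial as a function on {0,1}^n)
K : (n i : ℕ) → BitVec n → ℤ
K n i y = sumℤ (map (λ z → character z y) (levelSet n i))

expAbsPow : (n i a : ℕ) → ℚ
expAbsPow n i a =
  ℚ._/_ (+ sumℕ (map (λ y → ℤ.∣ K n i y ∣ ^ a) (allBitVecs n))) (2 ^ n) {{m^n≢0 2 n}}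

unionBefore : ∀ {r v} → (Fin v → Subset r) → Fin v → Subset r
unionBefore {v = v} S d = ⋃ (map S (boolFilter (λ j → toℕ j <ᵇ toℕ d) (allFin v)))

sumF2 : ∀ {n r} → Subset r → (Fin r → BitVec n) → BitVec n
sumF2 {n} {r} T x =
  foldr (zipWith _xor_) (replicate n false)
        (map x (boolFilter (lookup T) (allFin r)))

_=ᵇ_ : ∀ {n} → BitVec n → BitVec n → Bool
[] =ᵇ [] = true
(a ∷ x) =ᵇ (b ∷ y) = (if a then b else not b) ∧ (x =ᵇ y)

allᵇ : List Bool → Bool
allᵇ = foldr _∧_ true

inA : ∀ {n r v} → ℕ → (Fin v → Subset r) → Vec (BitVec n) (r ℕ.+ v) → Bool
inA {n} {r} {v} i S x =
  allᵇ (List.map (λ k → weight (lookup x k) ≡ᵇ i) (allFin (r ℕ.+ v)))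
  ∧ allᵇ (List.map (λ d → lookup x (r ↑ʳ d)
                              =ᵇ
                              sumF2 (S d) (λ j → lookup x (j ↑ˡ v)))
                   (allFin v))

cardA : (n i r v : ℕ) → (Fin v → Subset r) → ℕ
cardA n i r v S = length (boolFilter (inA {n} {r} {v} i S) (vecsOver (allBitVecs n) (r ℕ.+ v)))

aExp : ∀ {r v} → (Fin v → Subset r) → Fin v → ℕ
aExp S d = suc ∣ S d ─ unionBefore S d ∣

ℕtoℚ : ℕ → ℚ
ℕtoℚ k = ℚ._/_ (+ k) 1

{-# OPTIONS --safe #-}
-- Write 1_L(u) = 2⁻ⁿ Σ_y K(y) w_u(y).  A tuple of 𝒜 is determined by x ∈ L^r subject to
-- Σ_{j ∈ S_d} x_j ∈ L for every d, so 2^{nv} |𝒜| is the sum over x ∈ L^r of the products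
-- ∏_d Σ_{y_d} K(y_d) w_{Σ_{S_d} x}(y_d).  Impose the constraints in the order d = 1, …, v.
-- The coordinates in S_d ∖ ⋃_{j<d} S_j are new at step d; summing them over L turns the
-- character w_{Σ_{S_d} x}(y_d) into K(y_d)^{a_d - 1} times a character of the old
-- coordinates, of modulus 1, so step d costs at most a factor Σ_{y_d} |K(y_d)|^{a_d}.
-- The new parts partition ⋃_d S_d = [r], whence Σ_d a_d = r + v.
module Submission where

open import Defs

import Algebra.Properties.CommutativeSemigroup as CommSemigroupProperties
open import Data.Bool using (Bool; true; false; not; _∧_; _xor_; if_then_else_)
import Data.Bool.Properties as Boolₚ
open import Data.Empty using (⊥-elim)
open import Data.Fin using (Fin; zero; suc; toℕ; fromℕ<; _↑ˡ_; _↑ʳ_)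
import Data.Fin.Properties as Finₚ
open import Data.Fin.Subset using (Subset; Nonempty; _⊆_; ⋃; ⊤; ⊥; _∪_; _∩_; _─_; _∈_; _∉_; ∣_∣)
import Data.Fin.Subset.Properties as Subsetₚ
open import Data.Integer as ℤ using (ℤ; +_; 0ℤ; 1ℤ; -1ℤ; -[1+_])
import Data.Integer.Properties as ℤₚ
open import Data.List using (List; []; _∷_; _++_; _∷ʳ_; map; foldr; concatMap; allFin; tabulate; take; length)
import Data.List.Properties as Listₚ
open import Data.Nat as ℕ using (ℕ; _≤_; _+_; _≡ᵇ_; _<ᵇ_)
import Data.Nat.ListAction.Properties as NatListₚ
import Data.Nat.Properties as ℕₚ
open import Data.Nat.Solver using (module +-*-Solver)
open import Data.Product using (_×_; _,_)
import Data.Rational as ℚ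
import Data.Rational.Properties as ℚₚ
open import Data.Rational.Unnormalised as ℚᵘ using (ℚᵘ; mkℚᵘ)
import Data.Rational.Unnormalised.Properties as ℚᵘₚ
open import Data.Vec as Vec using (Vec; []; _∷_; lookup; replicate; zipWith; here; there)
import Data.Vec.Properties as Vecₚ
open import Function using (_∘_)
open import Relation.Binary.PropositionalEquality
  using (_≡_; refl; sym; trans; cong; cong₂; subst; subst₂; module ≡-Reasoning)
open import Relation.Nullary using (¬_)

private
  variable
    A B : Set
    n r : ℕ

module +-CS = CommSemigroupProperties ℤₚ.+-commutativeSemigroup
module *-CS = CommSemigroupProperties ℤₚ.*-commutativeSemigroup

∑ : (A → ℤ) → List A → ℤ
∑ f xs = sumℤ (map f xs)

∏ : (A → ℤ) → List A → ℤ
∏ f [] = 1ℤ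
∏ f (x ∷ xs) = f x ℤ.* ∏ f xs

𝟙 : Bool → ℤ
𝟙 true = 1ℤ
𝟙 false = 0ℤ

∑-cong : ∀ {f g : A → ℤ} xs → (∀ x → f x ≡ g x) → ∑ f xs ≡ ∑ g xs
∑-cong [] _ = refl
∑-cong (x ∷ xs) f≗g = cong₂ ℤ._+_ (f≗g x) (∑-cong xs f≗g)

∑-++ : ∀ (f : A → ℤ) xs ys → ∑ f (xs ++ ys) ≡ ∑ f xs ℤ.+ ∑ f ys
∑-++ f [] ys = sym (ℤₚ.+-identityˡ _)
∑-++ f (x ∷ xs) ys = trans (cong (ℤ._+_ (f x)) (∑-++ f xs ys)) (sym (ℤₚ.+-assoc (f x) _ _))

∑-map : ∀ (f : B → ℤ) (g : A → B) xs → ∑ f (map g xs) ≡ ∑ (f ∘ g) xs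
∑-map f g xs = cong sumℤ (sym (Listₚ.map-∘ xs))

∑-concatMap : ∀ (f : B → ℤ) (g : A → List B) xs →
  ∑ f (concatMap g xs) ≡ ∑ (λ x → ∑ f (g x)) xs
∑-concatMap f g [] = refl
∑-concatMap f g (x ∷ xs) =
  trans (∑-++ f (g x) (concatMap g xs)) (cong (ℤ._+_ (∑ f (g x))) (∑-concatMap f g xs))

∑-*ˡ : ∀ c (f : A → ℤ) xs → ∑ (λ x → c ℤ.* f x) xs ≡ c ℤ.* ∑ f xs
∑-*ˡ c f [] = sym (ℤₚ.*-zeroʳ c)
∑-*ˡ c f (x ∷ xs) =
  trans (cong (ℤ._+_ (c ℤ.* f x)) (∑-*ˡ c f xs)) (sym (ℤₚ.*-distribˡ-+ c (f x) _))

∑-*ʳ : ∀ c (f : A → ℤ) xs → ∑ (λ x → f x ℤ.* c) xs ≡ ∑ f xs ℤ.* c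
∑-*ʳ c f xs =
  trans (∑-cong xs (λ x → ℤₚ.*-comm (f x) c)) (trans (∑-*ˡ c f xs) (ℤₚ.*-comm c _))

∑-+ : ∀ (f g : A → ℤ) xs → ∑ (λ x → f x ℤ.+ g x) xs ≡ ∑ f xs ℤ.+ ∑ g xs
∑-+ f g [] = refl
∑-+ f g (x ∷ xs) =
  trans (cong (ℤ._+_ (f x ℤ.+ g x)) (∑-+ f g xs)) (+-CS.interchange (f x) (g x) _ _)

∑-0 : ∀ (xs : List A) → ∑ (λ _ → 0ℤ) xs ≡ 0ℤ
∑-0 [] = refl
∑-0 (x ∷ xs) = trans (ℤₚ.+-identityˡ _) (∑-0 xs)

∑-comm : ∀ (f : A → B → ℤ) xs ys → ∑ (λ x → ∑ (f x) ys) xs ≡ ∑ (λ y → ∑ (λ x → f x y) xs) ys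
∑-comm f [] ys = sym (∑-0 ys)
∑-comm f (x ∷ xs) ys =
  trans (cong (ℤ._+_ (∑ (f x) ys)) (∑-comm f xs ys)) (sym (∑-+ (f x) _ ys))

∑-mono-≤ : ∀ {f g : A → ℤ} xs → (∀ x → f x ℤ.≤ g x) → ∑ f xs ℤ.≤ ∑ g xs
∑-mono-≤ [] _ = ℤₚ.≤-refl
∑-mono-≤ (x ∷ xs) f≤g = ℤₚ.+-mono-≤ (f≤g x) (∑-mono-≤ xs f≤g)

∑-boolFilter : ∀ (p : A → Bool) (f : A → ℤ) xs →
  ∑ f (boolFilter p xs) ≡ ∑ (λ x → 𝟙 (p x) ℤ.* f x) xs
∑-boolFilter p f [] = refl
∑-boolFilter p f (x ∷ xs) with p x
... | true = cong₂ ℤ._+_ (sym (ℤₚ.*-identityˡ (f x))) (∑-boolFilter p f xs)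
... | false = trans (∑-boolFilter p f xs) (sym (ℤₚ.+-identityˡ _))

length-boolFilter : ∀ (p : A → Bool) xs → + length (boolFilter p xs) ≡ ∑ (𝟙 ∘ p) xs
length-boolFilter p [] = refl
length-boolFilter p (x ∷ xs) with p x
... | true = trans (ℤₚ.pos-+ 1 _) (cong (ℤ._+_ 1ℤ) (length-boolFilter p xs))
... | false = trans (length-boolFilter p xs) (sym (ℤₚ.+-identityˡ _))

sumℕ-map : ∀ (f : A → ℕ) xs → + sumℕ (map f xs) ≡ ∑ (+_ ∘ f) xs
sumℕ-map f [] = refl
sumℕ-map f (x ∷ xs) = trans (ℤₚ.pos-+ (f x) _) (cong (ℤ._+_ (+ f x)) (sumℕ-map f xs))

∏-∷ʳ : ∀ (f : A → ℤ) xs x → ∏ f (xs ∷ʳ x) ≡ ∏ f xs ℤ.* f x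
∏-∷ʳ f [] x = trans (ℤₚ.*-identityʳ (f x)) (sym (ℤₚ.*-identityˡ (f x)))
∏-∷ʳ f (y ∷ xs) x = trans (cong (ℤ._*_ (f y)) (∏-∷ʳ f xs x)) (sym (ℤₚ.*-assoc (f y) _ _))

∏-nonNeg : ∀ (f : A → ℤ) xs → (∀ x → 0ℤ ℤ.≤ f x) → 0ℤ ℤ.≤ ∏ f xs
∏-nonNeg f [] _ = ℤ.+≤+ ℕ.z≤n
∏-nonNeg f (x ∷ xs) f≥0 =
  subst (ℤ._≤ f x ℤ.* ∏ f xs) (ℤₚ.*-zeroʳ (f x))
    (ℤₚ.*-monoˡ-≤-nonNeg (f x) {{ℤ.nonNegative (f≥0 x)}} (∏-nonNeg f xs f≥0))

𝟙-nonNeg : ∀ b → 0ℤ ℤ.≤ 𝟙 b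
𝟙-nonNeg true = ℤ.+≤+ ℕ.z≤n
𝟙-nonNeg false = ℤ.+≤+ ℕ.z≤n

𝟙-∧ : ∀ a b → 𝟙 (a ∧ b) ≡ 𝟙 a ℤ.* 𝟙 b
𝟙-∧ true b = sym (ℤₚ.*-identityˡ (𝟙 b))
𝟙-∧ false b = refl

𝟙-allᵇ : ∀ (p : A → Bool) xs → 𝟙 (allᵇ (map p xs)) ≡ ∏ (𝟙 ∘ p) xs
𝟙-allᵇ p [] = refl
𝟙-allᵇ p (x ∷ xs) = trans (𝟙-∧ (p x) _) (cong (ℤ._*_ (𝟙 (p x))) (𝟙-allᵇ p xs))

i≤∣i∣ : ∀ i → i ℤ.≤ + ℤ.∣ i ∣
i≤∣i∣ (+ _) = ℤₚ.≤-refl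
i≤∣i∣ -[1+ _ ] = ℤ.-≤+

∣i^m∣≡∣i∣^m : ∀ i m → ℤ.∣ i ℤ.^ m ∣ ≡ ℤ.∣ i ∣ ℕ.^ m
∣i^m∣≡∣i∣^m i ℕ.zero = refl
∣i^m∣≡∣i∣^m i (ℕ.suc m) = trans (ℤₚ.∣i*j∣≡∣i∣*∣j∣ i _) (cong (ℤ.∣ i ∣ ℕ.*_) (∣i^m∣≡∣i∣^m i m))

i*j≤∣i∣ : ∀ i j → ℤ.∣ j ∣ ≡ 1 → i ℤ.* j ℤ.≤ + ℤ.∣ i ∣
i*j≤∣i∣ i j ∣j∣≡1 = subst (λ m → i ℤ.* j ℤ.≤ + m)
  (trans (ℤₚ.∣i*j∣≡∣i∣*∣j∣ i j) (trans (cong (ℤ.∣ i ∣ ℕ.*_) ∣j∣≡1) (ℕₚ.*-identityʳ _)))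
  (i≤∣i∣ (i ℤ.* j))

-- Characters of 𝔽₂ⁿ

sign : Bool → ℤ
sign b = if b then ℤ.- (+ 1) else + 1

sign-xor : ∀ a b → sign (a xor b) ≡ sign a ℤ.* sign b
sign-xor true true = refl
sign-xor true false = refl
sign-xor false true = refl
sign-xor false false = refl

sign-not : ∀ b → sign (not b) ≡ -1ℤ ℤ.* sign b
sign-not true = refl
sign-not false = refl

∧-distribʳ-xor : ∀ c a b → (a xor b) ∧ c ≡ (a ∧ c) xor (b ∧ c)
∧-distribʳ-xor c true true = sym (Boolₚ.xor-same c)
∧-distribʳ-xor c true false = sym (Boolₚ.xor-identityʳ c)
∧-distribʳ-xor c false b = refl

infixl 6 _⊕_
_⊕_ : BitVec n → BitVec n → BitVec n
_⊕_ = zipWith _xor_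

zeros : BitVec n
zeros = replicate _ false

character-⊕ : ∀ (u w y : BitVec n) → character (u ⊕ w) y ≡ character u y ℤ.* character w y
character-⊕ [] [] [] = refl
character-⊕ (a ∷ u) (b ∷ w) (c ∷ y) = begin
  sign (((a xor b) ∧ c) xor dotF2 (u ⊕ w) y)
    ≡⟨ sign-xor ((a xor b) ∧ c) _ ⟩
  sign ((a xor b) ∧ c) ℤ.* character (u ⊕ w) y
    ≡⟨ cong₂ ℤ._*_ (trans (cong sign (∧-distribʳ-xor c a b)) (sign-xor (a ∧ c) (b ∧ c)))
                   (character-⊕ u w y) ⟩
  sign (a ∧ c) ℤ.* sign (b ∧ c) ℤ.* (character u y ℤ.* character w y)
    ≡⟨ *-CS.interchange (sign (a ∧ c)) _ _ _ ⟩
  sign (a ∧ c) ℤ.* character u y ℤ.* (sign (b ∧ c) ℤ.* character w y)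
    ≡⟨ sym (cong₂ ℤ._*_ (sign-xor (a ∧ c) _) (sign-xor (b ∧ c) _)) ⟩
  character (a ∷ u) (c ∷ y) ℤ.* character (b ∷ w) (c ∷ y) ∎
  where open ≡-Reasoning

⊕-=ᵇ-zeros : ∀ (u w : BitVec n) → ((u ⊕ w) =ᵇ zeros) ≡ (u =ᵇ w)
⊕-=ᵇ-zeros [] [] = refl
⊕-=ᵇ-zeros (true ∷ u) (true ∷ w) = ⊕-=ᵇ-zeros u w
⊕-=ᵇ-zeros (true ∷ u) (false ∷ w) = refl
⊕-=ᵇ-zeros (false ∷ u) (true ∷ w) = refl
⊕-=ᵇ-zeros (false ∷ u) (false ∷ w) = ⊕-=ᵇ-zeros u w

∑-allBitVecs-suc : ∀ (f : BitVec (ℕ.suc n) → ℤ) →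
  ∑ f (allBitVecs (ℕ.suc n)) ≡ ∑ (f ∘ (false ∷_)) (allBitVecs n) ℤ.+ ∑ (f ∘ (true ∷_)) (allBitVecs n)
∑-allBitVecs-suc {n} f =
  trans (∑-concatMap f (λ a → map (a ∷_) (allBitVecs n)) (false ∷ true ∷ []))
        (cong₂ ℤ._+_ (∑-map f (false ∷_) (allBitVecs n))
                     (trans (ℤₚ.+-identityʳ _) (∑-map f (true ∷_) (allBitVecs n))))

∑-sift : ∀ n (t : BitVec n) (f : BitVec n → ℤ) →
  ∑ (λ a → 𝟙 (a =ᵇ t) ℤ.* f a) (allBitVecs n) ≡ f t
∑-sift ℕ.zero [] f = trans (ℤₚ.+-identityʳ _) (ℤₚ.*-identityˡ _)
∑-sift (ℕ.suc n) (false ∷ t) f =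
  trans (∑-allBitVecs-suc (λ a → 𝟙 (a =ᵇ (false ∷ t)) ℤ.* f a))
        (trans (cong₂ ℤ._+_ (∑-sift n t (f ∘ (false ∷_))) (∑-0 (allBitVecs n))) (ℤₚ.+-identityʳ _))
∑-sift (ℕ.suc n) (true ∷ t) f =
  trans (∑-allBitVecs-suc (λ a → 𝟙 (a =ᵇ (true ∷ t)) ℤ.* f a))
        (trans (cong₂ ℤ._+_ (∑-0 (allBitVecs n)) (∑-sift n t (f ∘ (true ∷_)))) (ℤₚ.+-identityˡ _))

∑-character : ∀ n (u : BitVec n) → ∑ (character u) (allBitVecs n) ≡ 𝟙 (u =ᵇ zeros) ℤ.* + 2 ℕ.^ n
∑-character ℕ.zero [] = refl
∑-character (ℕ.suc n) (false ∷ u) = begin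
  ∑ (character (false ∷ u)) (allBitVecs (ℕ.suc n))
    ≡⟨ ∑-allBitVecs-suc (character (false ∷ u)) ⟩
  ∑ (character u) (allBitVecs n) ℤ.+ ∑ (character u) (allBitVecs n)
    ≡⟨ cong₂ ℤ._+_ (∑-character n u) (∑-character n u) ⟩
  𝟙 (u =ᵇ zeros) ℤ.* + 2 ℕ.^ n ℤ.+ 𝟙 (u =ᵇ zeros) ℤ.* + 2 ℕ.^ n
    ≡⟨ sym (ℤₚ.*-distribˡ-+ (𝟙 (u =ᵇ zeros)) _ _) ⟩
  𝟙 (u =ᵇ zeros) ℤ.* (+ 2 ℕ.^ n ℤ.+ + 2 ℕ.^ n)
    ≡⟨ cong (ℤ._*_ (𝟙 (u =ᵇ zeros))) (trans (sym (ℤₚ.pos-+ (2 ℕ.^ n) _))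
                                           (cong (λ m → + (2 ℕ.^ n ℕ.+ m)) (sym (ℕₚ.+-identityʳ _)))) ⟩
  𝟙 (u =ᵇ zeros) ℤ.* + 2 ℕ.^ ℕ.suc n ∎
  where open ≡-Reasoning
∑-character (ℕ.suc n) (true ∷ u) = begin
  ∑ (character (true ∷ u)) (allBitVecs (ℕ.suc n))
    ≡⟨ ∑-allBitVecs-suc (character (true ∷ u)) ⟩
  χ ℤ.+ ∑ (λ y → sign (not (dotF2 u y))) (allBitVecs n)
    ≡⟨ cong (ℤ._+_ χ) (trans (∑-cong (allBitVecs n) (sign-not ∘ dotF2 u))
                             (∑-*ˡ -1ℤ (character u) (allBitVecs n))) ⟩
  χ ℤ.+ -1ℤ ℤ.* χ
    ≡⟨ cong (ℤ._+_ χ) (ℤₚ.-1*i≡-i χ) ⟩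
  χ ℤ.- χ
    ≡⟨ ℤₚ.+-inverseʳ χ ⟩
  0ℤ ∎
  where
  open ≡-Reasoning
  χ : ℤ
  χ = ∑ (character u) (allBitVecs n)

∑-K*character : ∀ n i (u : BitVec n) →
  ∑ (λ y → K n i y ℤ.* character u y) (allBitVecs n) ≡ 𝟙 (weight u ≡ᵇ i) ℤ.* + 2 ℕ.^ n
∑-K*character n i u = begin
  ∑ (λ y → K n i y ℤ.* character u y) Bₙ
    ≡⟨ ∑-cong Bₙ (λ y → sym (∑-*ʳ (character u y) (λ z → character z y) L)) ⟩
  ∑ (λ y → ∑ (λ z → character z y ℤ.* character u y) L) Bₙ
    ≡⟨ ∑-cong Bₙ (λ y → ∑-cong L (λ z → sym (character-⊕ z u y))) ⟩
  ∑ (λ y → ∑ (λ z → character (z ⊕ u) y) L) Bₙ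
    ≡⟨ ∑-comm (λ y z → character (z ⊕ u) y) Bₙ L ⟩
  ∑ (λ z → ∑ (character (z ⊕ u)) Bₙ) L
    ≡⟨ ∑-cong L (λ z → trans (∑-character n (z ⊕ u)) (cong (λ b → 𝟙 b ℤ.* 2ⁿ) (⊕-=ᵇ-zeros z u))) ⟩
  ∑ (λ z → 𝟙 (z =ᵇ u) ℤ.* 2ⁿ) L
    ≡⟨ ∑-boolFilter (λ z → weight z ≡ᵇ i) _ Bₙ ⟩
  ∑ (λ z → 𝟙 (weight z ≡ᵇ i) ℤ.* (𝟙 (z =ᵇ u) ℤ.* 2ⁿ)) Bₙ
    ≡⟨ ∑-cong Bₙ (λ z → *-CS.x∙yz≈y∙xz (𝟙 (weight z ≡ᵇ i)) (𝟙 (z =ᵇ u)) 2ⁿ) ⟩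
  ∑ (λ z → 𝟙 (z =ᵇ u) ℤ.* (𝟙 (weight z ≡ᵇ i) ℤ.* 2ⁿ)) Bₙ
    ≡⟨ ∑-sift n u (λ z → 𝟙 (weight z ≡ᵇ i) ℤ.* 2ⁿ) ⟩
  𝟙 (weight u ≡ᵇ i) ℤ.* 2ⁿ ∎
  where
  open ≡-Reasoning
  Bₙ L : List (BitVec n)
  Bₙ = allBitVecs n
  L = levelSet n i
  2ⁿ : ℤ
  2ⁿ = + 2 ℕ.^ n

∏character : Subset r → Vec (BitVec n) r → BitVec n → ℤ
∏character [] [] y = 1ℤ
∏character (s ∷ S) (x ∷ xs) y = (if s then character x y else 1ℤ) ℤ.* ∏character S xs y

∣∏character∣≡1 : ∀ (S : Subset r) (xs : Vec (BitVec n) r) y → ℤ.∣ ∏character S xs y ∣ ≡ 1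
∣∏character∣≡1 [] [] y = refl
∣∏character∣≡1 (s ∷ S) (x ∷ xs) y =
  trans (ℤₚ.∣i*j∣≡∣i∣*∣j∣ (if s then character x y else 1ℤ) _)
        (cong₂ ℕ._*_ (∣χ∣≡1 s) (∣∏character∣≡1 S xs y))
  where
  ∣χ∣≡1 : ∀ s → ℤ.∣ (if s then character x y else 1ℤ) ∣ ≡ 1
  ∣χ∣≡1 true with dotF2 x y
  ... | true = refl
  ... | false = refl
  ∣χ∣≡1 false = refl

dotF2-zeros : ∀ (y : BitVec n) → dotF2 zeros y ≡ false
dotF2-zeros [] = refl
dotF2-zeros (_ ∷ y) = dotF2-zeros y

map-lookup-boolFilter-suc : ∀ s (S : Subset r) (x : BitVec n) xs js →
  map (lookup (x ∷ xs)) (boolFilter (lookup (s ∷ S)) (map suc js))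
    ≡ map (lookup xs) (boolFilter (lookup S) js)
map-lookup-boolFilter-suc s S x xs [] = refl
map-lookup-boolFilter-suc s S x xs (j ∷ js) with lookup S j
... | true = cong (lookup xs j ∷_) (map-lookup-boolFilter-suc s S x xs js)
... | false = map-lookup-boolFilter-suc s S x xs js

sumF2-∷-tail : ∀ s (S : Subset r) (x : BitVec n) xs →
  foldr _⊕_ zeros (map (lookup (x ∷ xs)) (boolFilter (lookup (s ∷ S)) (tabulate suc)))
    ≡ sumF2 S (lookup xs)
sumF2-∷-tail {r} s S x xs = cong (foldr _⊕_ zeros) (trans
  (cong (map (lookup (x ∷ xs)) ∘ boolFilter (lookup (s ∷ S))) (sym (Listₚ.map-tabulate (λ j → j) suc)))
  (map-lookup-boolFilter-suc s S x xs (allFin r)))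

sumF2-∷ : ∀ s (S : Subset r) (x : BitVec n) xs →
  sumF2 (s ∷ S) (lookup (x ∷ xs)) ≡ (if s then x ⊕ sumF2 S (lookup xs) else sumF2 S (lookup xs))
sumF2-∷ true S x xs = cong (x ⊕_) (sumF2-∷-tail true S x xs)
sumF2-∷ false S x xs = sumF2-∷-tail false S x xs

sumF2-cong : ∀ (T : Subset r) {f g : Fin r → BitVec n} →
  (∀ t → t ∈ T → f t ≡ g t) → sumF2 T f ≡ sumF2 T g
sumF2-cong {r} T {f} {g} f≗g = cong (foldr _⊕_ zeros) (map-boolFilter-cong (allFin r))
  where
  map-boolFilter-cong : ∀ ts → map f (boolFilter (lookup T) ts) ≡ map g (boolFilter (lookup T) ts)
  map-boolFilter-cong [] = refl
  map-boolFilter-cong (t ∷ ts) with lookup T t in t∈T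
  ... | true = cong₂ _∷_ (f≗g t (Vecₚ.lookup⇒[]= t T t∈T)) (map-boolFilter-cong ts)
  ... | false = map-boolFilter-cong ts

character-sumF2 : ∀ (S : Subset r) (xs : Vec (BitVec n) r) y →
  character (sumF2 S (lookup xs)) y ≡ ∏character S xs y
character-sumF2 [] [] y = cong sign (dotF2-zeros y)
character-sumF2 (true ∷ S) (x ∷ xs) y = begin
  character (sumF2 (true ∷ S) (lookup (x ∷ xs))) y
    ≡⟨ cong (λ z → character z y) (sumF2-∷ true S x xs) ⟩
  character (x ⊕ sumF2 S (lookup xs)) y
    ≡⟨ character-⊕ x _ y ⟩
  character x y ℤ.* character (sumF2 S (lookup xs)) y
    ≡⟨ cong (ℤ._*_ (character x y)) (character-sumF2 S xs y) ⟩
  character x y ℤ.* ∏character S xs y ∎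
  where open ≡-Reasoning
character-sumF2 (false ∷ S) (x ∷ xs) y =
  trans (cong (λ z → character z y) (sumF2-∷ false S x xs))
        (trans (character-sumF2 S xs y) (sym (ℤₚ.*-identityˡ _)))

⋃-∷ʳ : ∀ (ps : List (Subset r)) p → ⋃ (ps ∷ʳ p) ≡ ⋃ ps ∪ p
⋃-∷ʳ [] p = trans (Subsetₚ.∪-identityʳ p) (sym (Subsetₚ.∪-identityˡ p))
⋃-∷ʳ (q ∷ ps) p = trans (cong (q ∪_) (⋃-∷ʳ ps p)) (sym (Subsetₚ.∪-assoc q (⋃ ps) p))

p∪q≡p∪[q─p] : ∀ (p q : Subset r) → p ∪ q ≡ p ∪ (q ─ p)
p∪q≡p∪[q─p] [] [] = refl
p∪q≡p∪[q─p] (true ∷ p) (_ ∷ q) = cong (true ∷_) (p∪q≡p∪[q─p] p q)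
p∪q≡p∪[q─p] (false ∷ p) (x ∷ q) = cong (x ∷_) (p∪q≡p∪[q─p] p q)

p∩[q─p]≡⊥ : ∀ (p q : Subset r) → p ∩ (q ─ p) ≡ ⊥
p∩[q─p]≡⊥ [] [] = refl
p∩[q─p]≡⊥ (true ∷ p) (_ ∷ q) = cong (false ∷_) (p∩[q─p]≡⊥ p q)
p∩[q─p]≡⊥ (false ∷ p) (_ ∷ q) = cong (false ∷_) (p∩[q─p]≡⊥ p q)

∣p∪q∣≡∣p∣+∣q─p∣ : ∀ (p q : Subset r) → ∣ p ∪ q ∣ ≡ ∣ p ∣ + ∣ q ─ p ∣
∣p∪q∣≡∣p∣+∣q─p∣ [] [] = refl
∣p∪q∣≡∣p∣+∣q─p∣ (true ∷ p) (_ ∷ q) = cong ℕ.suc (∣p∪q∣≡∣p∣+∣q─p∣ p q)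
∣p∪q∣≡∣p∣+∣q─p∣ (false ∷ p) (true ∷ q) =
  trans (cong ℕ.suc (∣p∪q∣≡∣p∣+∣q─p∣ p q)) (sym (ℕₚ.+-suc ∣ p ∣ _))
∣p∪q∣≡∣p∣+∣q─p∣ (false ∷ p) (false ∷ q) = ∣p∪q∣≡∣p∣+∣q─p∣ p q

x∈p⇒x∉q─p : ∀ {p q : Subset r} {t} → t ∈ p → t ∉ q ─ p
x∈p⇒x∉q─p {p = true ∷ p} {_ ∷ q} here ()
x∈p⇒x∉q─p {p = _ ∷ p} {_ ∷ q} (there t∈p) (there t∈q─p) = x∈p⇒x∉q─p t∈p t∈q─p

∣p─q∣≡0⇒p⊆q : ∀ (p q : Subset r) → ∣ p ─ q ∣ ≡ 0 → p ⊆ q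
∣p─q∣≡0⇒p⊆q (_ ∷ p) (true ∷ q) _ here = here
∣p─q∣≡0⇒p⊆q (_ ∷ p) (true ∷ q) ∣p─q∣≡0 (there t∈p) = there (∣p─q∣≡0⇒p⊆q p q ∣p─q∣≡0 t∈p)
∣p─q∣≡0⇒p⊆q (false ∷ p) (false ∷ q) ∣p─q∣≡0 (there t∈p) = there (∣p─q∣≡0⇒p⊆q p q ∣p─q∣≡0 t∈p)
∣p─q∣≡0⇒p⊆q (true ∷ p) (false ∷ q) ()

indicesBefore : ∀ {v} → Fin v → List (Fin v)
indicesBefore {v} d = boolFilter (λ j → toℕ j <ᵇ toℕ d) (allFin v)

boolFilter-map : ∀ (p : B → Bool) (f : A → B) xs → boolFilter p (map f xs) ≡ map f (boolFilter (p ∘ f) xs)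
boolFilter-map p f [] = refl
boolFilter-map p f (x ∷ xs) with p (f x)
... | true = cong (f x ∷_) (boolFilter-map p f xs)
... | false = boolFilter-map p f xs

tabulate-suc : ∀ v → tabulate suc ≡ map suc (allFin v)
tabulate-suc v = sym (Listₚ.map-tabulate (λ j → j) (suc {v}))

boolFilter-<ᵇ-allFin : ∀ v k → boolFilter (λ j → toℕ j <ᵇ k) (allFin v) ≡ take k (allFin v)
boolFilter-<ᵇ-allFin ℕ.zero ℕ.zero = refl
boolFilter-<ᵇ-allFin ℕ.zero (ℕ.suc k) = refl
boolFilter-<ᵇ-allFin (ℕ.suc v) ℕ.zero =
  trans (cong (boolFilter (λ j → toℕ j <ᵇ 0)) (tabulate-suc v))
        (trans (boolFilter-map _ suc (allFin v)) (cong (map suc) (boolFilter-<ᵇ-allFin v 0)))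
boolFilter-<ᵇ-allFin (ℕ.suc v) (ℕ.suc k) = cong (zero ∷_) (begin
  boolFilter (λ j → toℕ j <ᵇ ℕ.suc k) (tabulate suc)
    ≡⟨ cong (boolFilter (λ j → toℕ j <ᵇ ℕ.suc k)) (tabulate-suc v) ⟩
  boolFilter (λ j → toℕ j <ᵇ ℕ.suc k) (map suc (allFin v))
    ≡⟨ boolFilter-map _ suc (allFin v) ⟩
  map suc (boolFilter (λ j → toℕ j <ᵇ k) (allFin v))
    ≡⟨ cong (map suc) (boolFilter-<ᵇ-allFin v k) ⟩
  map suc (take k (allFin v))
    ≡⟨ sym (Listₚ.take-map k (allFin v)) ⟩
  take k (map suc (allFin v))
    ≡⟨ cong (take k) (sym (tabulate-suc v)) ⟩
  take k (tabulate suc) ∎)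
  where open ≡-Reasoning

allFin-snoc-induction : ∀ {v} (Q : List (Fin v) → Set) → Q [] →
  (∀ d → Q (indicesBefore d) → Q (indicesBefore d ∷ʳ d)) → Q (allFin v)
allFin-snoc-induction {v} Q Q[] Q-snoc =
  subst Q (Listₚ.take-all v (allFin v) (ℕₚ.≤-reflexive (Listₚ.length-tabulate (λ j → j))))
        (Q-take v ℕₚ.≤-refl)
  where
  Q-take : ∀ k → k ≤ v → Q (take k (allFin v))
  Q-take ℕ.zero _ = Q[]
  Q-take (ℕ.suc k) k<v = subst Q (sym take-suc) (subst (λ ds → Q (ds ∷ʳ d)) before-d
    (Q-snoc d (subst Q (sym before-d) (Q-take k (ℕₚ.<⇒≤ k<v)))))
    where
    d : Fin v
    d = fromℕ< k<v
    before-d : indicesBefore d ≡ take k (allFin v)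
    before-d = trans (cong (λ m → boolFilter (λ j → toℕ j <ᵇ m) (allFin v)) (Finₚ.toℕ-fromℕ< k<v))
                     (boolFilter-<ᵇ-allFin v k)
    take-suc : take (ℕ.suc k) (allFin v) ≡ take k (allFin v) ∷ʳ d
    take-suc = subst (λ m → take (ℕ.suc m) (allFin v) ≡ take m (allFin v) ∷ʳ d)
                     (Finₚ.toℕ-fromℕ< k<v) (Listₚ.take-suc-tabulate (λ j → j) d)

∑-vecsOver-suc : ∀ (Ls : List A) r (F : Vec A (ℕ.suc r) → ℤ) →
  ∑ F (vecsOver Ls (ℕ.suc r)) ≡ ∑ (λ a → ∑ (F ∘ (a ∷_)) (vecsOver Ls r)) Ls
∑-vecsOver-suc Ls r F =
  trans (∑-concatMap F (λ a → map (a ∷_) (vecsOver Ls r)) Ls)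
        (∑-cong Ls (λ a → ∑-map F (a ∷_) (vecsOver Ls r)))

∑-vecsOver-+ : ∀ (Ls : List A) r v (F : Vec A (r + v) → ℤ) →
  ∑ F (vecsOver Ls (r + v)) ≡ ∑ (λ xs → ∑ (λ ys → F (xs Vec.++ ys)) (vecsOver Ls v)) (vecsOver Ls r)
∑-vecsOver-+ Ls ℕ.zero v F = sym (ℤₚ.+-identityʳ _)
∑-vecsOver-+ Ls (ℕ.suc r) v F =
  trans (∑-vecsOver-suc Ls (r + v) F)
        (trans (∑-cong Ls (λ a → ∑-vecsOver-+ Ls r v (F ∘ (a ∷_))))
               (sym (∑-vecsOver-suc Ls r _)))

map-allFin-suc : ∀ {v} (f : Fin (ℕ.suc v) → A) → map f (allFin (ℕ.suc v)) ≡ f zero ∷ map (f ∘ suc) (allFin v)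
map-allFin-suc {v = v} f =
  cong (f zero ∷_) (trans (cong (map f) (tabulate-suc v)) (sym (Listₚ.map-∘ (allFin v))))

allᵇ-allFin-+ : ∀ r v (f : Fin (r + v) → Bool) →
  allᵇ (map f (allFin (r + v))) ≡ allᵇ (map (f ∘ (_↑ˡ v)) (allFin r)) ∧ allᵇ (map (f ∘ (r ↑ʳ_)) (allFin v))
allᵇ-allFin-+ ℕ.zero v f = refl
allᵇ-allFin-+ (ℕ.suc r) v f = begin
  allᵇ (map f (allFin (ℕ.suc r + v)))
    ≡⟨ cong allᵇ (map-allFin-suc f) ⟩
  f zero ∧ allᵇ (map (f ∘ suc) (allFin (r + v)))
    ≡⟨ cong (f zero ∧_) (allᵇ-allFin-+ r v (f ∘ suc)) ⟩
  f zero ∧ (allᵇ (map (f ∘ suc ∘ (_↑ˡ v)) (allFin r)) ∧ allᵇ (map (f ∘ (ℕ.suc r ↑ʳ_)) (allFin v)))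
    ≡⟨ sym (Boolₚ.∧-assoc (f zero) _ _) ⟩
  (f zero ∧ allᵇ (map (f ∘ suc ∘ (_↑ˡ v)) (allFin r))) ∧ allᵇ (map (f ∘ (ℕ.suc r ↑ʳ_)) (allFin v))
    ≡⟨ cong (λ bs → allᵇ bs ∧ allᵇ (map (f ∘ (ℕ.suc r ↑ʳ_)) (allFin v)))
            (sym (map-allFin-suc (f ∘ (_↑ˡ v)))) ⟩
  allᵇ (map (f ∘ (_↑ˡ v)) (allFin (ℕ.suc r))) ∧ allᵇ (map (f ∘ (ℕ.suc r ↑ʳ_)) (allFin v)) ∎
  where open ≡-Reasoning

𝟙-allᵇ-allFin-suc : ∀ {k} (g : Fin (ℕ.suc k) → Bool) c →
  𝟙 (allᵇ (map g (allFin (ℕ.suc k)))) ℤ.* c ≡ 𝟙 (g zero) ℤ.* (𝟙 (allᵇ (map (g ∘ suc) (allFin k))) ℤ.* c)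
𝟙-allᵇ-allFin-suc g c =
  trans (cong (λ b → 𝟙 b ℤ.* c) (cong allᵇ (map-allFin-suc g)))
        (trans (cong (ℤ._* c) (𝟙-∧ (g zero) _)) (ℤₚ.*-assoc (𝟙 (g zero)) _ c))

∑-vecsOver-sift : ∀ v (t : Fin v → BitVec n) (f : Vec (BitVec n) v → ℤ) →
  ∑ (λ ys → 𝟙 (allᵇ (map (λ d → lookup ys d =ᵇ t d) (allFin v))) ℤ.* f ys) (vecsOver (allBitVecs n) v)
    ≡ f (Vec.tabulate t)
∑-vecsOver-sift ℕ.zero t f = trans (ℤₚ.+-identityʳ _) (ℤₚ.*-identityˡ _)
∑-vecsOver-sift {n} (ℕ.suc v) t f = begin
  ∑ (λ ys → 𝟙 (eqs (ℕ.suc v) t ys) ℤ.* f ys) (vecsOver Bₙ (ℕ.suc v))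
    ≡⟨ ∑-vecsOver-suc Bₙ v _ ⟩
  ∑ (λ a → ∑ (λ ys → 𝟙 (eqs (ℕ.suc v) t (a ∷ ys)) ℤ.* f (a ∷ ys)) (vecsOver Bₙ v)) Bₙ
    ≡⟨ ∑-cong Bₙ (λ a → ∑-cong (vecsOver Bₙ v) (λ ys →
         𝟙-allᵇ-allFin-suc (λ d → lookup (a ∷ ys) d =ᵇ t d) (f (a ∷ ys)))) ⟩
  ∑ (λ a → ∑ (λ ys → 𝟙 (a =ᵇ t zero) ℤ.* (𝟙 (eqs v (t ∘ suc) ys) ℤ.* f (a ∷ ys))) (vecsOver Bₙ v)) Bₙ
    ≡⟨ ∑-cong Bₙ (λ a → trans (∑-*ˡ (𝟙 (a =ᵇ t zero)) _ (vecsOver Bₙ v))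
                              (cong (ℤ._*_ (𝟙 (a =ᵇ t zero))) (∑-vecsOver-sift v (t ∘ suc) (f ∘ (a ∷_))))) ⟩
  ∑ (λ a → 𝟙 (a =ᵇ t zero) ℤ.* f (a ∷ Vec.tabulate (t ∘ suc))) Bₙ
    ≡⟨ ∑-sift n (t zero) (λ a → f (a ∷ Vec.tabulate (t ∘ suc))) ⟩
  f (Vec.tabulate t) ∎
  where
  open ≡-Reasoning
  Bₙ : List (BitVec n)
  Bₙ = allBitVecs n
  eqs : ∀ k → (Fin k → BitVec n) → Vec (BitVec n) k → Bool
  eqs k s ys = allᵇ (map (λ d → lookup ys d =ᵇ s d) (allFin k))

∑-vecsOver-boolFilter : ∀ (p : A → Bool) (Ls : List A) r (F : Vec A r → ℤ) →
  ∑ (λ xs → 𝟙 (allᵇ (map (λ k → p (lookup xs k)) (allFin r))) ℤ.* F xs) (vecsOver Ls r)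
    ≡ ∑ F (vecsOver (boolFilter p Ls) r)
∑-vecsOver-boolFilter p Ls ℕ.zero F = cong (ℤ._+ 0ℤ) (ℤₚ.*-identityˡ (F []))
∑-vecsOver-boolFilter p Ls (ℕ.suc r) F = begin
  ∑ (λ xs → 𝟙 (all-p (ℕ.suc r) xs) ℤ.* F xs) (vecsOver Ls (ℕ.suc r))
    ≡⟨ ∑-vecsOver-suc Ls r _ ⟩
  ∑ (λ a → ∑ (λ xs → 𝟙 (all-p (ℕ.suc r) (a ∷ xs)) ℤ.* F (a ∷ xs)) (vecsOver Ls r)) Ls
    ≡⟨ ∑-cong Ls (λ a → ∑-cong (vecsOver Ls r) (λ xs →
         𝟙-allᵇ-allFin-suc (λ k → p (lookup (a ∷ xs) k)) (F (a ∷ xs)))) ⟩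
  ∑ (λ a → ∑ (λ xs → 𝟙 (p a) ℤ.* (𝟙 (all-p r xs) ℤ.* F (a ∷ xs))) (vecsOver Ls r)) Ls
    ≡⟨ ∑-cong Ls (λ a → trans (∑-*ˡ (𝟙 (p a)) _ (vecsOver Ls r))
                              (cong (ℤ._*_ (𝟙 (p a))) (∑-vecsOver-boolFilter p Ls r (F ∘ (a ∷_))))) ⟩
  ∑ (λ a → 𝟙 (p a) ℤ.* ∑ (F ∘ (a ∷_)) (vecsOver (boolFilter p Ls) r)) Ls
    ≡⟨ sym (∑-boolFilter p _ Ls) ⟩
  ∑ (λ a → ∑ (F ∘ (a ∷_)) (vecsOver (boolFilter p Ls) r)) (boolFilter p Ls)
    ≡⟨ sym (∑-vecsOver-suc (boolFilter p Ls) r F) ⟩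
  ∑ F (vecsOver (boolFilter p Ls) (ℕ.suc r)) ∎
  where
  open ≡-Reasoning
  all-p : ∀ k → Vec _ k → Bool
  all-p k xs = allᵇ (map (λ j → p (lookup xs j)) (allFin k))

AgreeOutside : Subset r → Vec A r → Vec A r → Set
AgreeOutside P b x = ∀ t → t ∉ P → lookup x t ≡ lookup b t

AgreeOutside-inside : ∀ {P : Subset r} {b x : Vec A r} {a c} →
  AgreeOutside P b x → AgreeOutside (true ∷ P) (c ∷ b) (a ∷ x)
AgreeOutside-inside agree zero 0∉ = ⊥-elim (0∉ here)
AgreeOutside-inside agree (suc t) t∉ = agree t (t∉ ∘ there)

AgreeOutside-outside : ∀ {P : Subset r} {b x : Vec A r} {c} →
  AgreeOutside P b x → AgreeOutside (false ∷ P) (c ∷ b) (c ∷ x)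
AgreeOutside-outside agree zero _ = refl
AgreeOutside-outside agree (suc t) t∉ = agree t (t∉ ∘ there)

DependsOnlyOn : Subset r → (Vec A r → ℤ) → Set
DependsOnlyOn U G = ∀ x z → (∀ t → t ∈ U → lookup x t ≡ lookup z t) → G x ≡ G z

module PartialSums {A : Set} (Ls : List A) where

  -- ∑on P b F sums F x over the x with entries from Ls on P that agree with b outside P.
  ∑on : Subset r → Vec A r → (Vec A r → ℤ) → ℤ
  ∑on [] [] F = F []
  ∑on (true ∷ P) (_ ∷ b) F = ∑ (λ a → ∑on P b (F ∘ (a ∷_))) Ls
  ∑on (false ∷ P) (c ∷ b) F = ∑on P b (F ∘ (c ∷_))

  ∑on-cong-AgreeOutside : ∀ (P : Subset r) b {F G : Vec A r → ℤ} →
    (∀ x → AgreeOutside P b x → F x ≡ G x) → ∑on P b F ≡ ∑on P b G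
  ∑on-cong-AgreeOutside [] [] F≗G = F≗G [] (λ ())
  ∑on-cong-AgreeOutside (true ∷ P) (_ ∷ b) F≗G =
    ∑-cong Ls (λ a → ∑on-cong-AgreeOutside P b (λ x agree → F≗G (a ∷ x) (AgreeOutside-inside agree)))
  ∑on-cong-AgreeOutside (false ∷ P) (c ∷ b) F≗G =
    ∑on-cong-AgreeOutside P b (λ x agree → F≗G (c ∷ x) (AgreeOutside-outside agree))

  ∑on-cong : ∀ (P : Subset r) b {F G : Vec A r → ℤ} → (∀ x → F x ≡ G x) → ∑on P b F ≡ ∑on P b G
  ∑on-cong P b F≗G = ∑on-cong-AgreeOutside P b (λ x _ → F≗G x)

  ∑on-*ˡ : ∀ (P : Subset r) b c (F : Vec A r → ℤ) → ∑on P b (λ x → c ℤ.* F x) ≡ c ℤ.* ∑on P b F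
  ∑on-*ˡ [] [] c F = refl
  ∑on-*ˡ (true ∷ P) (_ ∷ b) c F =
    trans (∑-cong Ls (λ a → ∑on-*ˡ P b c (F ∘ (a ∷_)))) (∑-*ˡ c _ Ls)
  ∑on-*ˡ (false ∷ P) (c₀ ∷ b) c F = ∑on-*ˡ P b c (F ∘ (c₀ ∷_))

  ∑on-∑ : ∀ (P : Subset r) b (G : B → Vec A r → ℤ) ys →
    ∑on P b (λ x → ∑ (λ y → G y x) ys) ≡ ∑ (λ y → ∑on P b (G y)) ys
  ∑on-∑ [] [] G ys = refl
  ∑on-∑ (true ∷ P) (_ ∷ b) G ys =
    trans (∑-cong Ls (λ a → ∑on-∑ P b (λ y → G y ∘ (a ∷_)) ys))
          (∑-comm (λ a y → ∑on P b (G y ∘ (a ∷_))) Ls ys)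
  ∑on-∑ (false ∷ P) (c ∷ b) G ys = ∑on-∑ P b (λ y → G y ∘ (c ∷_)) ys

  ∑on-mono-≤ : ∀ (P : Subset r) b {F G : Vec A r → ℤ} →
    (∀ x → F x ℤ.≤ G x) → ∑on P b F ℤ.≤ ∑on P b G
  ∑on-mono-≤ [] [] F≤G = F≤G []
  ∑on-mono-≤ (true ∷ P) (_ ∷ b) F≤G = ∑-mono-≤ Ls (λ a → ∑on-mono-≤ P b (F≤G ∘ (a ∷_)))
  ∑on-mono-≤ (false ∷ P) (c ∷ b) F≤G = ∑on-mono-≤ P b (F≤G ∘ (c ∷_))

  ∑on-⊥ : ∀ (b : Vec A r) F → ∑on ⊥ b F ≡ F b
  ∑on-⊥ [] F = refl
  ∑on-⊥ (c ∷ b) F = ∑on-⊥ b (F ∘ (c ∷_))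

  ∑on-⊤ : ∀ (b : Vec A r) F → ∑on ⊤ b F ≡ ∑ F (vecsOver Ls r)
  ∑on-⊤ [] F = sym (ℤₚ.+-identityʳ (F []))
  ∑on-⊤ {ℕ.suc r} (_ ∷ b) F =
    trans (∑-cong Ls (λ a → ∑on-⊤ b (F ∘ (a ∷_)))) (sym (∑-vecsOver-suc Ls r F))

  ∑on-∪ : ∀ (P Q : Subset r) b F → P ∩ Q ≡ ⊥ → ∑on (P ∪ Q) b F ≡ ∑on P b (λ x → ∑on Q x F)
  ∑on-∪ [] [] [] F _ = refl
  ∑on-∪ (true ∷ P) (true ∷ Q) (_ ∷ b) F ()
  ∑on-∪ (true ∷ P) (false ∷ Q) (_ ∷ b) F P∩Q≡⊥ =
    ∑-cong Ls (λ a → ∑on-∪ P Q b (F ∘ (a ∷_)) (Vecₚ.∷-injectiveʳ P∩Q≡⊥))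
  ∑on-∪ (false ∷ P) (true ∷ Q) (c ∷ b) F P∩Q≡⊥ =
    trans (∑-cong Ls (λ a → ∑on-∪ P Q b (F ∘ (a ∷_)) (Vecₚ.∷-injectiveʳ P∩Q≡⊥)))
          (sym (∑on-∑ P b (λ a x → ∑on Q x (F ∘ (a ∷_))) Ls))
  ∑on-∪ (false ∷ P) (false ∷ Q) (c ∷ b) F P∩Q≡⊥ =
    ∑on-∪ P Q b (F ∘ (c ∷_)) (Vecₚ.∷-injectiveʳ P∩Q≡⊥)

  ∑on-∪─ : ∀ (U Q : Subset r) b {G : Vec A r → ℤ} F → DependsOnlyOn U G →
    ∑on (U ∪ (Q ─ U)) b (λ x → G x ℤ.* F x) ≡ ∑on U b (λ x → G x ℤ.* ∑on (Q ─ U) x F)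
  ∑on-∪─ U Q b {G} F G-on-U =
    trans (∑on-∪ U (Q ─ U) b _ (p∩[q─p]≡⊥ U Q)) (∑on-cong U b (λ x →
      trans (∑on-cong-AgreeOutside (Q ─ U) x (λ z agree →
               cong (ℤ._* F z) (G-on-U z x (λ t t∈U → agree t (x∈p⇒x∉q─p t∈U)))))
            (∑on-*ˡ (Q ─ U) x (G x) F)))

module LevelSet (n i : ℕ) where

  open PartialSums (levelSet n i) public

  𝟙L : BitVec n → ℤ
  𝟙L z = 𝟙 (weight z ≡ᵇ i)

  absMomentSum : ℕ → ℕ
  absMomentSum a = sumℕ (map (λ y → ℤ.∣ K n i y ∣ ℕ.^ a) (allBitVecs n))

  ∑on-∏character : ∀ (S U : Subset r) b y →
    ∑on (S ─ U) b (λ x → ∏character S x y) ≡ K n i y ℤ.^ ∣ S ─ U ∣ ℤ.* ∏character (S ∩ U) b y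
  ∑on-∏character [] [] [] y = refl
  ∑on-∏character (true ∷ S) (true ∷ U) (c ∷ b) y =
    trans (∑on-*ˡ (S ─ U) b (character c y) _)
          (trans (cong (ℤ._*_ (character c y)) (∑on-∏character S U b y))
                 (*-CS.x∙yz≈y∙xz (character c y) (K n i y ℤ.^ ∣ S ─ U ∣) _))
  ∑on-∏character (false ∷ S) (true ∷ U) (c ∷ b) y =
    trans (∑on-*ˡ (S ─ U) b 1ℤ _)
          (trans (cong (ℤ._*_ 1ℤ) (∑on-∏character S U b y)) (*-CS.x∙yz≈y∙xz 1ℤ (K n i y ℤ.^ ∣ S ─ U ∣) _))
  ∑on-∏character (false ∷ S) (false ∷ U) (c ∷ b) y =
    trans (∑on-*ˡ (S ─ U) b 1ℤ _)
          (trans (cong (ℤ._*_ 1ℤ) (∑on-∏character S U b y)) (*-CS.x∙yz≈y∙xz 1ℤ (K n i y ℤ.^ ∣ S ─ U ∣) _))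
  ∑on-∏character (true ∷ S) (false ∷ U) (_ ∷ b) y = begin
    ∑ (λ a → ∑on (S ─ U) b (λ x → character a y ℤ.* ∏character S x y)) L
      ≡⟨ ∑-cong L (λ a → trans (∑on-*ˡ (S ─ U) b (character a y) _)
                               (cong (ℤ._*_ (character a y)) (∑on-∏character S U b y))) ⟩
    ∑ (λ a → character a y ℤ.* Kᵐ∏) L
      ≡⟨ ∑-*ʳ Kᵐ∏ (λ a → character a y) L ⟩
    K n i y ℤ.* Kᵐ∏
      ≡⟨ sym (ℤₚ.*-assoc (K n i y) _ _) ⟩
    K n i y ℤ.^ ℕ.suc ∣ S ─ U ∣ ℤ.* ∏character (S ∩ U) b y
      ≡⟨ cong (ℤ._*_ (K n i y ℤ.^ ℕ.suc ∣ S ─ U ∣)) (sym (ℤₚ.*-identityˡ _)) ⟩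
    K n i y ℤ.^ ℕ.suc ∣ S ─ U ∣ ℤ.* (1ℤ ℤ.* ∏character (S ∩ U) b y) ∎
    where
    open ≡-Reasoning
    L : List (BitVec n)
    L = levelSet n i
    Kᵐ∏ : ℤ
    Kᵐ∏ = K n i y ℤ.^ ∣ S ─ U ∣ ℤ.* ∏character (S ∩ U) b y

  ∑on-K*character-sumF2 : ∀ (S U : Subset r) b y →
    ∑on (S ─ U) b (λ x → K n i y ℤ.* character (sumF2 S (lookup x)) y)
      ≡ K n i y ℤ.^ ℕ.suc ∣ S ─ U ∣ ℤ.* ∏character (S ∩ U) b y
  ∑on-K*character-sumF2 S U b y = begin
    ∑on (S ─ U) b (λ x → K n i y ℤ.* character (sumF2 S (lookup x)) y)
      ≡⟨ ∑on-cong (S ─ U) b (λ x → cong (ℤ._*_ (K n i y)) (character-sumF2 S x y)) ⟩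
    ∑on (S ─ U) b (λ x → K n i y ℤ.* ∏character S x y)
      ≡⟨ ∑on-*ˡ (S ─ U) b (K n i y) _ ⟩
    K n i y ℤ.* ∑on (S ─ U) b (λ x → ∏character S x y)
      ≡⟨ cong (ℤ._*_ (K n i y)) (∑on-∏character S U b y) ⟩
    K n i y ℤ.* (K n i y ℤ.^ ∣ S ─ U ∣ ℤ.* ∏character (S ∩ U) b y)
      ≡⟨ sym (ℤₚ.*-assoc (K n i y) _ _) ⟩
    K n i y ℤ.^ ℕ.suc ∣ S ─ U ∣ ℤ.* ∏character (S ∩ U) b y ∎
    where open ≡-Reasoning

  -- Expanding 2ⁿ 1_L = Σ_y K(y) w_·(y) and summing out the coordinates in S ─ U leaves
  -- K(y)^(1 + |S ─ U|) times a character of the remaining coordinates, of modulus 1.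
  2ⁿ*∑on-𝟙L-sumF2-≤ : ∀ (S U : Subset r) b →
    + 2 ℕ.^ n ℤ.* ∑on (S ─ U) b (𝟙L ∘ sumF2 S ∘ lookup) ℤ.≤ + absMomentSum (ℕ.suc ∣ S ─ U ∣)
  2ⁿ*∑on-𝟙L-sumF2-≤ S U b = begin
    2ⁿ ℤ.* ∑on N b (𝟙L ∘ sumF2 S ∘ lookup)
      ≡⟨ sym (∑on-*ˡ N b 2ⁿ _) ⟩
    ∑on N b (λ x → 2ⁿ ℤ.* 𝟙L (sumF2 S (lookup x)))
      ≡⟨ ∑on-cong N b (λ x → trans (ℤₚ.*-comm 2ⁿ _) (sym (∑-K*character n i (sumF2 S (lookup x))))) ⟩
    ∑on N b (λ x → ∑ (λ y → K n i y ℤ.* character (sumF2 S (lookup x)) y) Bₙ)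
      ≡⟨ ∑on-∑ N b (λ y x → K n i y ℤ.* character (sumF2 S (lookup x)) y) Bₙ ⟩
    ∑ (λ y → ∑on N b (λ x → K n i y ℤ.* character (sumF2 S (lookup x)) y)) Bₙ
      ≡⟨ ∑-cong Bₙ (∑on-K*character-sumF2 S U b) ⟩
    ∑ (λ y → K n i y ℤ.^ ℕ.suc ∣ N ∣ ℤ.* ∏character (S ∩ U) b y) Bₙ
      ≤⟨ ∑-mono-≤ Bₙ (λ y → i*j≤∣i∣ (K n i y ℤ.^ ℕ.suc ∣ N ∣) _ (∣∏character∣≡1 (S ∩ U) b y)) ⟩
    ∑ (λ y → + ℤ.∣ K n i y ℤ.^ ℕ.suc ∣ N ∣ ∣) Bₙ
      ≡⟨ ∑-cong Bₙ (λ y → cong +_ (∣i^m∣≡∣i∣^m (K n i y) (ℕ.suc ∣ N ∣))) ⟩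
    ∑ (λ y → + (ℤ.∣ K n i y ∣ ℕ.^ ℕ.suc ∣ N ∣)) Bₙ
      ≡⟨ sym (sumℕ-map (λ y → ℤ.∣ K n i y ∣ ℕ.^ ℕ.suc ∣ N ∣) Bₙ) ⟩
    + absMomentSum (ℕ.suc ∣ N ∣) ∎
    where
    open ℤₚ.≤-Reasoning
    N : Subset _
    N = S ─ U
    Bₙ : List (BitVec n)
    Bₙ = allBitVecs n
    2ⁿ : ℤ
    2ⁿ = + 2 ℕ.^ n

-- The exponents a_d

coveredBy : ∀ {v} → (Fin v → Subset r) → List (Fin v) → Subset r
coveredBy S ds = ⋃ (map S ds)

coveredBy-∷ʳ : ∀ {v} (S : Fin v → Subset r) ds d →
  coveredBy S (ds ∷ʳ d) ≡ coveredBy S ds ∪ (S d ─ coveredBy S ds)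
coveredBy-∷ʳ S ds d =
  trans (cong ⋃ (Listₚ.map-++ S ds (d ∷ [])))
        (trans (⋃-∷ʳ (map S ds) (S d)) (p∪q≡p∪[q─p] (coveredBy S ds) (S d)))

aExp≥2 : ∀ {v} (S : Fin v → Subset r) d → ¬ (S d ⊆ unionBefore S d) → 2 ≤ aExp S d
aExp≥2 S d Sd⊈ with ∣ S d ─ unionBefore S d ∣ in ∣new∣≡
... | ℕ.zero = ⊥-elim (Sd⊈ (∣p─q∣≡0⇒p⊆q (S d) _ ∣new∣≡))
... | ℕ.suc _ = ℕ.s≤s (ℕ.s≤s ℕ.z≤n)

sumℕ-aExp : ∀ {v} (S : Fin v → Subset r) → sumℕ (map (aExp S) (allFin v)) ≡ ∣ coveredBy S (allFin v) ∣ + v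
sumℕ-aExp {r} {v} S =
  subst (λ m → sumℕ (map (aExp S) (allFin v)) ≡ ∣ coveredBy S (allFin v) ∣ + m)
        (Listₚ.length-tabulate (λ j → j))
        (allFin-snoc-induction Q (sym (trans (ℕₚ.+-identityʳ _) (Subsetₚ.∣⊥∣≡0 r))) Q-snoc)
  where
  Q : List (Fin v) → Set
  Q ds = sumℕ (map (aExp S) ds) ≡ ∣ coveredBy S ds ∣ + length ds
  Q-snoc : ∀ d → Q (indicesBefore d) → Q (indicesBefore d ∷ʳ d)
  Q-snoc d Q-ds = begin
    sumℕ (map (aExp S) (ds ∷ʳ d))
      ≡⟨ cong sumℕ (Listₚ.map-++ (aExp S) ds (d ∷ [])) ⟩
    sumℕ (map (aExp S) ds ++ aExp S d ∷ [])
      ≡⟨ NatListₚ.sum-++ (map (aExp S) ds) (aExp S d ∷ []) ⟩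
    sumℕ (map (aExp S) ds) + (ℕ.suc ∣ S d ─ U ∣ + 0)
      ≡⟨ cong (_+ (ℕ.suc ∣ S d ─ U ∣ + 0)) Q-ds ⟩
    ∣ U ∣ + length ds + (ℕ.suc ∣ S d ─ U ∣ + 0)
      ≡⟨ solve 3 (λ u k m → u :+ k :+ (con 1 :+ m :+ con 0) := u :+ m :+ (k :+ con 1))
                           refl (∣ U ∣) (length ds) (∣ S d ─ U ∣) ⟩
    ∣ U ∣ + ∣ S d ─ U ∣ + (length ds + 1)
      ≡⟨ cong₂ _+_ (sym (∣p∪q∣≡∣p∣+∣q─p∣ U (S d))) (sym (Listₚ.length-++ ds)) ⟩
    ∣ U ∪ S d ∣ + length (ds ∷ʳ d)
      ≡⟨ cong (λ W → ∣ W ∣ + length (ds ∷ʳ d)) (p∪q≡p∪[q─p] U (S d)) ⟩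
    ∣ U ∪ (S d ─ U) ∣ + length (ds ∷ʳ d)
      ≡⟨ cong (λ W → ∣ W ∣ + length (ds ∷ʳ d)) (sym (coveredBy-∷ʳ S ds d)) ⟩
    ∣ coveredBy S (ds ∷ʳ d) ∣ + length (ds ∷ʳ d) ∎
    where
    open ≡-Reasoning
    open +-*-Solver using (solve; _:+_; _:=_; con)
    ds : List (Fin v)
    ds = indicesBefore d
    U : Subset _
    U = coveredBy S ds

-- Adding the constraints one at a time

module Constraints (n i : ℕ) {r v} (S : Fin v → Subset r) where

  open LevelSet n i

  constraints : List (Fin v) → Vec (BitVec n) r → ℤ
  constraints ds x = ∏ (λ d → 𝟙L (sumF2 (S d) (lookup x))) ds

  constraints-dependsOnly : ∀ ds → DependsOnlyOn (coveredBy S ds) (constraints ds)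
  constraints-dependsOnly [] x z _ = refl
  constraints-dependsOnly (d ∷ ds) x z x≈z = cong₂ ℤ._*_
    (cong 𝟙L (sumF2-cong (S d) (λ t t∈Sd → x≈z t (Subsetₚ.p⊆p∪q (coveredBy S ds) t∈Sd))))
    (constraints-dependsOnly ds x z (λ t t∈U → x≈z t (Subsetₚ.q⊆p∪q (S d) (coveredBy S ds) t∈U)))

  ∑on-constraints-∷ʳ : ∀ ds d b →
    ∑on (coveredBy S (ds ∷ʳ d)) b (constraints (ds ∷ʳ d))
      ≡ ∑on (coveredBy S ds) b
            (λ x → constraints ds x ℤ.* ∑on (S d ─ coveredBy S ds) x (𝟙L ∘ sumF2 (S d) ∘ lookup))
  ∑on-constraints-∷ʳ ds d b = begin
    ∑on (coveredBy S (ds ∷ʳ d)) b (constraints (ds ∷ʳ d))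
      ≡⟨ cong (λ W → ∑on W b (constraints (ds ∷ʳ d))) (coveredBy-∷ʳ S ds d) ⟩
    ∑on (U ∪ (S d ─ U)) b (constraints (ds ∷ʳ d))
      ≡⟨ ∑on-cong (U ∪ (S d ─ U)) b (λ x → ∏-∷ʳ _ ds d) ⟩
    ∑on (U ∪ (S d ─ U)) b (λ x → constraints ds x ℤ.* 𝟙L (sumF2 (S d) (lookup x)))
      ≡⟨ ∑on-∪─ U (S d) b _ (constraints-dependsOnly ds) ⟩
    ∑on U b (λ x → constraints ds x ℤ.* ∑on (S d ─ U) x (𝟙L ∘ sumF2 (S d) ∘ lookup)) ∎
    where
    open ≡-Reasoning
    U : Subset r
    U = coveredBy S ds

  2ⁿ : ℤ
  2ⁿ = + 2 ℕ.^ n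

  Bounded : List (Fin v) → Set
  Bounded ds = ∀ b → ∏ (λ _ → 2ⁿ) ds ℤ.* ∑on (coveredBy S ds) b (constraints ds)
                       ℤ.≤ ∏ (λ d → + absMomentSum (aExp S d)) ds

  Bounded-[] : Bounded []
  Bounded-[] b = ℤₚ.≤-reflexive (trans (ℤₚ.*-identityˡ _) (∑on-⊥ b (constraints [])))

  -- aExp S d is definitionally suc ∣ S d ─ U ∣, as unionBefore S d = coveredBy S (indicesBefore d).
  Bounded-snoc : ∀ d → Bounded (indicesBefore d) → Bounded (indicesBefore d ∷ʳ d)
  Bounded-snoc d bounded b = begin
    ∏ (λ _ → 2ⁿ) (ds ∷ʳ d) ℤ.* ∑on (coveredBy S (ds ∷ʳ d)) b (constraints (ds ∷ʳ d))
      ≡⟨ cong₂ ℤ._*_ (∏-∷ʳ _ ds d) (∑on-constraints-∷ʳ ds d b) ⟩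
    2ᵏ ℤ.* 2ⁿ ℤ.* ∑on U b (λ x → constraints ds x ℤ.* M x)
      ≡⟨ ℤₚ.*-assoc 2ᵏ 2ⁿ _ ⟩
    2ᵏ ℤ.* (2ⁿ ℤ.* ∑on U b (λ x → constraints ds x ℤ.* M x))
      ≡⟨ cong (ℤ._*_ 2ᵏ) (trans (sym (∑on-*ˡ U b 2ⁿ _))
                                (∑on-cong U b (λ x → *-CS.x∙yz≈y∙xz 2ⁿ (constraints ds x) (M x)))) ⟩
    2ᵏ ℤ.* ∑on U b (λ x → constraints ds x ℤ.* (2ⁿ ℤ.* M x))
      ≤⟨ ℤₚ.*-monoˡ-≤-nonNeg 2ᵏ {{ℤ.nonNegative (∏-nonNeg _ ds (λ _ → ℤ.+≤+ ℕ.z≤n))}}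
           (∑on-mono-≤ U b (λ x → ℤₚ.*-monoˡ-≤-nonNeg (constraints ds x)
             {{ℤ.nonNegative (∏-nonNeg _ ds (λ _ → 𝟙-nonNeg _))}}
             (2ⁿ*∑on-𝟙L-sumF2-≤ (S d) U x))) ⟩
    2ᵏ ℤ.* ∑on U b (λ x → constraints ds x ℤ.* Tᵈ)
      ≡⟨ cong (ℤ._*_ 2ᵏ) (trans (∑on-cong U b (λ x → ℤₚ.*-comm _ Tᵈ))
                                (trans (∑on-*ˡ U b Tᵈ _) (ℤₚ.*-comm Tᵈ _))) ⟩
    2ᵏ ℤ.* (∑on U b (constraints ds) ℤ.* Tᵈ)
      ≡⟨ sym (ℤₚ.*-assoc 2ᵏ _ Tᵈ) ⟩
    2ᵏ ℤ.* ∑on U b (constraints ds) ℤ.* Tᵈ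
      ≤⟨ ℤₚ.*-monoʳ-≤-nonNeg Tᵈ (bounded b) ⟩
    ∏ (λ d → + absMomentSum (aExp S d)) ds ℤ.* Tᵈ
      ≡⟨ sym (∏-∷ʳ _ ds d) ⟩
    ∏ (λ d → + absMomentSum (aExp S d)) (ds ∷ʳ d) ∎
    where
    open ℤₚ.≤-Reasoning
    ds : List (Fin v)
    ds = indicesBefore d
    U : Subset r
    U = coveredBy S ds
    2ᵏ Tᵈ : ℤ
    2ᵏ = ∏ (λ _ → 2ⁿ) ds
    Tᵈ = + absMomentSum (aExp S d)
    M : Vec (BitVec n) r → ℤ
    M x = ∑on (S d ─ U) x (𝟙L ∘ sumF2 (S d) ∘ lookup)

  2ⁿᵛ*∑on-constraints-≤ : Bounded (allFin v)
  2ⁿᵛ*∑on-constraints-≤ = allFin-snoc-induction Bounded Bounded-[] Bounded-snoc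

  allInL : ∀ {k} → Vec (BitVec n) k → Bool
  allInL {k} xs = allᵇ (map (λ j → weight (lookup xs j) ≡ᵇ i) (allFin k))

  targets : Vec (BitVec n) r → Fin v → BitVec n
  targets xs d = sumF2 (S d) (lookup xs)

  solves : Vec (BitVec n) r → Vec (BitVec n) v → Bool
  solves xs ys = allᵇ (map (λ d → lookup ys d =ᵇ targets xs d) (allFin v))

  inA-++ : ∀ xs ys → inA i S (xs Vec.++ ys) ≡ (allInL xs ∧ allInL ys) ∧ solves xs ys
  inA-++ xs ys = cong₂ _∧_
    (trans (allᵇ-allFin-+ r v (λ k → weight (lookup (xs Vec.++ ys) k) ≡ᵇ i))
           (cong₂ (λ ps qs → allᵇ ps ∧ allᵇ qs)
                  (Listₚ.map-cong (λ j → cong (λ z → weight z ≡ᵇ i) (Vecₚ.lookup-++ˡ xs ys j)) (allFin r))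
                  (Listₚ.map-cong (λ d → cong (λ z → weight z ≡ᵇ i) (Vecₚ.lookup-++ʳ xs ys d)) (allFin v))))
    (cong allᵇ (Listₚ.map-cong (λ d → cong₂ _=ᵇ_ (Vecₚ.lookup-++ʳ xs ys d)
                                                 (sumF2-cong (S d) (λ t _ → Vecₚ.lookup-++ˡ xs ys t)))
                               (allFin v)))

  𝟙-inA-++ : ∀ xs ys → 𝟙 (inA i S (xs Vec.++ ys)) ≡ 𝟙 (allInL xs) ℤ.* (𝟙 (solves xs ys) ℤ.* 𝟙 (allInL ys))
  𝟙-inA-++ xs ys = begin
    𝟙 (inA i S (xs Vec.++ ys))
      ≡⟨ cong 𝟙 (inA-++ xs ys) ⟩
    𝟙 ((allInL xs ∧ allInL ys) ∧ solves xs ys)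
      ≡⟨ trans (𝟙-∧ (allInL xs ∧ allInL ys) _) (cong (ℤ._* 𝟙 (solves xs ys)) (𝟙-∧ (allInL xs) _)) ⟩
    𝟙 (allInL xs) ℤ.* 𝟙 (allInL ys) ℤ.* 𝟙 (solves xs ys)
      ≡⟨ trans (ℤₚ.*-assoc (𝟙 (allInL xs)) _ _) (cong (ℤ._*_ (𝟙 (allInL xs))) (ℤₚ.*-comm (𝟙 (allInL ys)) _)) ⟩
    𝟙 (allInL xs) ℤ.* (𝟙 (solves xs ys) ℤ.* 𝟙 (allInL ys)) ∎
    where open ≡-Reasoning

  𝟙-allInL-tabulate : ∀ xs → 𝟙 (allInL (Vec.tabulate (targets xs))) ≡ constraints (allFin v) xs
  𝟙-allInL-tabulate xs =
    trans (cong (𝟙 ∘ allᵇ) (Listₚ.map-cong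
            (λ d → cong (λ z → weight z ≡ᵇ i) (Vecₚ.lookup∘tabulate (targets xs) d)) (allFin v)))
          (𝟙-allᵇ (λ d → weight (targets xs d) ≡ᵇ i) (allFin v))

  -- The last v coordinates of a tuple in 𝒜 are determined by the first r.
  cardA≡∑-constraints : + cardA n i r v S ≡ ∑ (constraints (allFin v)) (vecsOver (levelSet n i) r)
  cardA≡∑-constraints = begin
    + cardA n i r v S
      ≡⟨ length-boolFilter (inA i S) (vecsOver Bₙ (r + v)) ⟩
    ∑ (𝟙 ∘ inA i S) (vecsOver Bₙ (r + v))
      ≡⟨ ∑-vecsOver-+ Bₙ r v (𝟙 ∘ inA i S) ⟩
    ∑ (λ xs → ∑ (λ ys → 𝟙 (inA i S (xs Vec.++ ys))) (vecsOver Bₙ v)) (vecsOver Bₙ r)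
      ≡⟨ ∑-cong (vecsOver Bₙ r) (λ xs → trans (∑-cong (vecsOver Bₙ v) (𝟙-inA-++ xs))
                                               (∑-*ˡ (𝟙 (allInL xs)) _ (vecsOver Bₙ v))) ⟩
    ∑ (λ xs → 𝟙 (allInL xs) ℤ.* ∑ (λ ys → 𝟙 (solves xs ys) ℤ.* 𝟙 (allInL ys)) (vecsOver Bₙ v)) (vecsOver Bₙ r)
      ≡⟨ ∑-cong (vecsOver Bₙ r) (λ xs → cong (ℤ._*_ (𝟙 (allInL xs)))
           (trans (∑-vecsOver-sift v (targets xs) (𝟙 ∘ allInL)) (𝟙-allInL-tabulate xs))) ⟩
    ∑ (λ xs → 𝟙 (allInL xs) ℤ.* constraints (allFin v) xs) (vecsOver Bₙ r)
      ≡⟨ ∑-vecsOver-boolFilter (λ z → weight z ≡ᵇ i) Bₙ r (constraints (allFin v)) ⟩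
    ∑ (constraints (allFin v)) (vecsOver (levelSet n i) r) ∎
    where
    open ≡-Reasoning
    Bₙ : List (BitVec n)
    Bₙ = allBitVecs n

  cardA*2ⁿᵛ-≤ : ⋃ (map S (allFin v)) ≡ ⊤ →
    + cardA n i r v S ℤ.* ∏ (λ _ → 2ⁿ) (allFin v) ℤ.≤ ∏ (λ d → + absMomentSum (aExp S d)) (allFin v)
  cardA*2ⁿᵛ-≤ covering = begin
    + cardA n i r v S ℤ.* 2ⁿᵛ
      ≡⟨ ℤₚ.*-comm (+ cardA n i r v S) 2ⁿᵛ ⟩
    2ⁿᵛ ℤ.* + cardA n i r v S
      ≡⟨ cong (ℤ._*_ 2ⁿᵛ) (trans cardA≡∑-constraints (sym (∑on-⊤ b (constraints (allFin v))))) ⟩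
    2ⁿᵛ ℤ.* ∑on ⊤ b (constraints (allFin v))
      ≡⟨ cong (λ W → 2ⁿᵛ ℤ.* ∑on W b (constraints (allFin v))) (sym covering) ⟩
    2ⁿᵛ ℤ.* ∑on (coveredBy S (allFin v)) b (constraints (allFin v))
      ≤⟨ 2ⁿᵛ*∑on-constraints-≤ b ⟩
    ∏ (λ d → + absMomentSum (aExp S d)) (allFin v) ∎
    where
    open ℤₚ.≤-Reasoning
    2ⁿᵛ : ℤ
    2ⁿᵛ = ∏ (λ _ → 2ⁿ) (allFin v)
    b : Vec (BitVec n) r
    b = replicate r zeros

-- From integers to rationals

prodᵘ : List ℚᵘ → ℚᵘ
prodᵘ = foldr ℚᵘ._*_ ℚᵘ.1ℚᵘ

toℚᵘ-/ : ∀ a D .{{_ : ℕ.NonZero D}} → ℚ.toℚᵘ ((+ a) ℚ./ D) ℚᵘ.≃ mkℚᵘ (+ a) (ℕ.pred D)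
toℚᵘ-/ a D = ℚᵘₚ.≃-trans (ℚₚ.toℚᵘ-cong (ℚₚ./-cong {+ a} {D} refl (sym (ℕₚ.suc-pred D))))
                         (ℚₚ.toℚᵘ-fromℚᵘ (mkℚᵘ (+ a) (ℕ.pred D)))

toℚᵘ-prodℚ-/ : ∀ D .{{_ : ℕ.NonZero D}} (t : A → ℕ) ds →
  ℚ.toℚᵘ (prodℚ (map (λ d → (+ t d) ℚ./ D) ds)) ℚᵘ.≃ prodᵘ (map (λ d → mkℚᵘ (+ t d) (ℕ.pred D)) ds)
toℚᵘ-prodℚ-/ D t [] = ℚᵘₚ.≃-refl
toℚᵘ-prodℚ-/ D t (d ∷ ds) =
  ℚᵘₚ.≃-trans (ℚₚ.toℚᵘ-homo-* ((+ t d) ℚ./ D) _) (ℚᵘₚ.*-cong (toℚᵘ-/ (t d) D) (toℚᵘ-prodℚ-/ D t ds))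

↥-* : ∀ p q → ℚᵘ.↥ (p ℚᵘ.* q) ≡ ℚᵘ.↥ p ℤ.* ℚᵘ.↥ q
↥-* (mkℚᵘ _ _) (mkℚᵘ _ _) = refl

↧-* : ∀ p q → ℚᵘ.↧ (p ℚᵘ.* q) ≡ ℚᵘ.↧ p ℤ.* ℚᵘ.↧ q
↧-* (mkℚᵘ _ b) (mkℚᵘ _ d) = ℤₚ.pos-* (ℕ.suc b) (ℕ.suc d)

↥-prodᵘ : ∀ (t : A → ℕ) e ds → ℚᵘ.↥ (prodᵘ (map (λ d → mkℚᵘ (+ t d) e) ds)) ≡ ∏ (+_ ∘ t) ds
↥-prodᵘ t e [] = refl
↥-prodᵘ t e (d ∷ ds) =
  trans (↥-* (mkℚᵘ (+ t d) e) (prodᵘ (map (λ d → mkℚᵘ (+ t d) e) ds)))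
        (cong (ℤ._*_ (+ t d)) (↥-prodᵘ t e ds))

↧-prodᵘ : ∀ (t : A → ℕ) e ds → ℚᵘ.↧ (prodᵘ (map (λ d → mkℚᵘ (+ t d) e) ds)) ≡ ∏ (λ _ → + ℕ.suc e) ds
↧-prodᵘ t e [] = refl
↧-prodᵘ t e (d ∷ ds) =
  trans (↧-* (mkℚᵘ (+ t d) e) (prodᵘ (map (λ d → mkℚᵘ (+ t d) e) ds)))
        (cong (ℤ._*_ (+ ℕ.suc e)) (↧-prodᵘ t e ds))

-- In ℚᵘ a product of fractions a/D is not normalised: its numerator is the product of the
-- a and its denominator is a power of D.
ℕtoℚ-≤-prodℚ : ∀ D .{{_ : ℕ.NonZero D}} (t : A → ℕ) ds C →
  + C ℤ.* ∏ (λ _ → + D) ds ℤ.≤ ∏ (+_ ∘ t) ds → ℕtoℚ C ℚ.≤ prodℚ (map (λ d → (+ t d) ℚ./ D) ds)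
ℕtoℚ-≤-prodℚ D t ds C C*Dᵏ≤∏t = ℚₚ.toℚᵘ-cancel-≤
  (ℚᵘₚ.≤-respˡ-≃ (ℚᵘₚ.≃-sym (toℚᵘ-/ C 1))
    (ℚᵘₚ.≤-respʳ-≃ (ℚᵘₚ.≃-sym (toℚᵘ-prodℚ-/ D t ds)) (ℚᵘ.*≤* C*↧P≤↥P)))
  where
  P : ℚᵘ
  P = prodᵘ (map (λ d → mkℚᵘ (+ t d) (ℕ.pred D)) ds)
  ↧P≡Dᵏ : ℚᵘ.↧ P ≡ ∏ (λ _ → + D) ds
  ↧P≡Dᵏ = trans (↧-prodᵘ t (ℕ.pred D) ds) (cong (λ m → ∏ (λ _ → + m) ds) (ℕₚ.suc-pred D))
  C*↧P≤↥P : + C ℤ.* ℚᵘ.↧ P ℤ.≤ ℚᵘ.↥ P ℤ.* + 1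
  C*↧P≤↥P = subst₂ ℤ._≤_ (cong (ℤ._*_ (+ C)) (sym ↧P≡Dᵏ))
                         (trans (sym (↥-prodᵘ t (ℕ.pred D) ds)) (sym (ℤₚ.*-identityʳ _)))
                         C*Dᵏ≤∏t

lemma3p5 : (n i r v : ℕ) → i ≤ n → 1 ≤ v → v ≤ r →
    (S : Fin v → Subset r) →
    (∀ d → Nonempty (S d)) →
    (∀ d → ¬ (S d ⊆ unionBefore S d)) →
    ⋃ (map S (allFin v)) ≡ ⊤ →
    (∀ d → 2 ≤ aExp S d)
    × sumℕ (map (aExp S) (allFin v)) ≡ r + v
    × (ℚ._≤_ (ℕtoℚ (cardA n i r v S))
             (prodℚ (map (λ d → expAbsPow n i (aExp S d)) (allFin v))))
lemma3p5 n i r v _ _ _ S _ S⊈before covering =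
    (λ d → aExp≥2 S d (S⊈before d))
  , trans (sumℕ-aExp S) (cong (_+ v) (trans (cong ∣_∣ covering) (Subsetₚ.∣⊤∣≡n r)))
  , ℕtoℚ-≤-prodℚ (2 ℕ.^ n) {{ℕₚ.m^n≢0 2 n}} (LevelSet.absMomentSum n i ∘ aExp S) (allFin v) (cardA n i r v S)
                 (Constraints.cardA*2ⁿᵛ-≤ n i S covering)
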